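{- Let $G$ be a graph without isolated vertices containing no member of $\mathcal{H}=\{C_6,C_6^1,C_6^2,C_6^3\}$ as an induced subgraph, and let $G^*$ be its auxiliary graph. For every clique $K$ of $G^*$ there exists a vertex $v\in V(G)$ such that $K\subseteq N_G(v)$.
   Context: Graphs are finite, simple, undirected. $C_6$ is the $6$-cycle with bipartition into independent sets of size $3$; $C_6^1,C_6^2,C_6^3$ are obtained from $C_6$ by adding respectively $1,2,3$ edges among the three vertices of one of the two parts. The auxiliary graph $G^*$ has vertex set $V(G)$ and edge set $\{uv: d_G(u,v)=2\}$. -}

module Defs where

open import Data.Nat using (ℕ)
open import Data.Bool using (Bool; true; false; _∨_; _∧_; T)
open import Data.Fin using (Fin; toℕ)
open import Data.Fin.Subset using (Subset; _∈_)
open import Data.Product using (Σ; ∃; ∃-syntax; _×_; _,_)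
open import Relation.Nullary using (¬_)
open import Relation.Binary using (Decidable)
open import Relation.Binary.PropositionalEquality using (_≡_; _≢_)
open import Function.Definitions using (Injective)
open import Function.Bundles using (_⇔_)

record Graph (n : ℕ) : Set₁ where
  field
    Adj    : Fin n → Fin n → Set
    adj?   : Decidable Adj
    sym    : ∀ {u v} → Adj u v → Adj v u
    irrefl : ∀ {u} → ¬ Adj u u
open Graph public

_∈N[_]_ : ∀ {n} → Fin n → Graph n → Fin n → Set
u ∈N[ G ] v = Adj G v u

NoIsolated : ∀ {n} → Graph n → Set
NoIsolated {n} G = ∀ (u : Fin n) → ∃[ v ] Adj G u v

Dist2 : ∀ {n} → Graph n → Fin n → Fin n → Set
Dist2 G u v = u ≢ v × ¬ Adj G u v × ∃[ w ] (Adj G u w × Adj G w v)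

-- The auxiliary graph G* as its adjacency relation: uv ∈ E(G*) iff d_G(u,v) = 2.
StarAdj : ∀ {n} → Graph n → Fin n → Fin n → Set
StarAdj = Dist2

IsStarClique : ∀ {n} → Graph n → Subset n → Set
IsStarClique {n} G K =
  (∃[ u ] u ∈ K) ×
  (∀ (u v : Fin n) → u ∈ K → v ∈ K → u ≢ v → StarAdj G u v)

-- Boolean adjacency tables on vertex set Fin 6 = {0,...,5}.
-- C6: cycle 0-1-2-3-4-5-0; bipartition {0,2,4} ∪ {1,3,5}.
c6 : ℕ → ℕ → Bool
c6 0 1 = true
c6 1 2 = true
c6 2 3 = true
c6 3 4 = true
c6 4 5 = true
c6 0 5 = true
c6 _ _ = false

-- extra edges inside the part {0,2,4}
e02 e24 e04 : ℕ → ℕ → Bool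
e02 0 2 = true
e02 _ _ = false
e24 2 4 = true
e24 _ _ = false
e04 0 4 = true
e04 _ _ = false

sym𝔹 : (ℕ → ℕ → Bool) → ℕ → ℕ → Bool
sym𝔹 f i j = f i j ∨ f j i

-- Adjacency of C6, C6^1, C6^2, C6^3 (k = number of added edges).
C6-adj C6¹-adj C6²-adj C6³-adj : Fin 6 → Fin 6 → Bool
C6-adj  i j = sym𝔹 c6 (toℕ i) (toℕ j)
C6¹-adj i j = sym𝔹 (λ a b → c6 a b ∨ e02 a b) (toℕ i) (toℕ j)
C6²-adj i j = sym𝔹 (λ a b → c6 a b ∨ e02 a b ∨ e24 a b) (toℕ i) (toℕ j)
C6³-adj i j = sym𝔹 (λ a b → c6 a b ∨ e02 a b ∨ e24 a b ∨ e04 a b) (toℕ i) (toℕ j)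

InducedSub6 : ∀ {n} → (Fin 6 → Fin 6 → Bool) → Graph n → Set
InducedSub6 {n} H G =
  Σ (Fin 6 → Fin n) λ f →
    Injective _≡_ _≡_ f × (∀ i j → Adj G (f i) (f j) ⇔ T (H i j))

ℋ-free : ∀ {n} → Graph n → Set
ℋ-free G =
  ¬ InducedSub6 C6-adj G × ¬ InducedSub6 C6¹-adj G ×
  ¬ InducedSub6 C6²-adj G × ¬ InducedSub6 C6³-adj G

{-# OPTIONS --safe #-}
-- Grow a vertex dominating ever more of K.  Suppose v₀ dominates a and a set
-- M ⊆ K, v₁ dominates b and M, but v₀ ≁ b and v₁ ≁ a.  Let z be a common
-- neighbour of a and b (they are at distance 2).  If some c ∈ M were not
-- adjacent to z, then v₀ c v₁ b z a would be a 6-cycle whose antipodal pairs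
-- are non-adjacent and whose vertices c, b, a (pairwise at distance 2) are
-- independent, i.e. an induced member of ℋ whichever chords v₀, v₁, z span.
-- So z dominates M ∪ {a, b}.
module Submission where

open import Defs
open import Data.Nat using (ℕ)
open import Data.Fin using (Fin; zero; suc; _≟_)
open import Data.Fin.Subset using (Subset; _∈_)
open import Data.Fin.Subset.Properties using (_∈?_)
open import Data.Fin.Properties using (all?)
open import Data.Bool using (Bool; true; false; T)
import Data.Bool.Properties as Bool
open import Data.Product using (Σ; ∃-syntax; _×_; _,_; proj₁; proj₂)
open import Data.Empty using (⊥-elim)
open import Data.Unit using (tt)
open import Data.List using (List; []; _∷_; allFin)
open import Data.List.Relation.Unary.All as All using (All; []; _∷_)
open import Data.List.Membership.Propositional.Properties using (∈-allFin)
open import Relation.Nullary using (¬_; yes; no; Dec)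
open import Relation.Nullary.Decidable using (True; toWitness; _→-dec_)
open import Relation.Binary.PropositionalEquality using (_≡_; _≢_; refl; subst)
  renaming (sym to ≡-sym)
open import Function.Base using (_∘_; id)
open import Function.Bundles using (_⇔_; mk⇔)

pattern f0 = zero
pattern f1 = suc zero
pattern f2 = suc (suc zero)
pattern f3 = suc (suc (suc zero))
pattern f4 = suc (suc (suc (suc zero)))
pattern f5 = suc (suc (suc (suc (suc zero))))

hexagon : Bool → Bool → Bool → Fin 6 → Fin 6 → Bool
hexagon b₀₂ b₂₄ b₀₄ f0 f1 = true
hexagon b₀₂ b₂₄ b₀₄ f1 f0 = true
hexagon b₀₂ b₂₄ b₀₄ f1 f2 = true
hexagon b₀₂ b₂₄ b₀₄ f2 f1 = true
hexagon b₀₂ b₂₄ b₀₄ f2 f3 = true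
hexagon b₀₂ b₂₄ b₀₄ f3 f2 = true
hexagon b₀₂ b₂₄ b₀₄ f3 f4 = true
hexagon b₀₂ b₂₄ b₀₄ f4 f3 = true
hexagon b₀₂ b₂₄ b₀₄ f4 f5 = true
hexagon b₀₂ b₂₄ b₀₄ f5 f4 = true
hexagon b₀₂ b₂₄ b₀₄ f0 f5 = true
hexagon b₀₂ b₂₄ b₀₄ f5 f0 = true
hexagon b₀₂ b₂₄ b₀₄ f0 f2 = b₀₂
hexagon b₀₂ b₂₄ b₀₄ f2 f0 = b₀₂
hexagon b₀₂ b₂₄ b₀₄ f2 f4 = b₂₄
hexagon b₀₂ b₂₄ b₀₄ f4 f2 = b₂₄
hexagon b₀₂ b₂₄ b₀₄ f0 f4 = b₀₄
hexagon b₀₂ b₂₄ b₀₄ f4 f0 = b₀₄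
hexagon b₀₂ b₂₄ b₀₄ _ _ = false

rotate₂ : Fin 6 → Fin 6
rotate₂ f0 = f2
rotate₂ f1 = f3
rotate₂ f2 = f4
rotate₂ f3 = f5
rotate₂ f4 = f0
rotate₂ f5 = f1

DistinctColumns : (Fin 6 → Fin 6 → Bool) → Set
DistinctColumns H = ∀ i j → (∀ k → H k i ≡ H k j) → i ≡ j

distinctColumns? : ∀ H → Dec (DistinctColumns H)
distinctColumns? H = all? λ i → all? λ j → all? (λ k → H k i Bool.≟ H k j) →-dec (i ≟ j)

SameTable : (Fin 6 → Fin 6 → Bool) → (Fin 6 → Fin 6 → Bool) → Set
SameTable H₁ H₂ = ∀ i j → H₁ i j ≡ H₂ i j

sameTable? : ∀ H₁ H₂ → Dec (SameTable H₁ H₂)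
sameTable? H₁ H₂ = all? λ i → all? λ j → H₁ i j Bool.≟ H₂ i j

module _ {n : ℕ} (G : Graph n) where

  AdjIs : Bool → Fin n → Fin n → Set
  AdjIs true  u v = Adj G u v
  AdjIs false u v = ¬ Adj G u v

  adjIs? : ∀ u v → Σ Bool λ b → AdjIs b u v
  adjIs? u v with adj? G u v
  ... | yes uv = true , uv
  ... | no ¬uv = false , ¬uv

  AdjIs-sym : ∀ b {u v} → AdjIs b u v → AdjIs b v u
  AdjIs-sym true  uv  = sym G uv
  AdjIs-sym false ¬uv = ¬uv ∘ sym G

  AdjIs-functional : ∀ b c {u v} → AdjIs b u v → AdjIs c u v → b ≡ c
  AdjIs-functional true  true  _   _   = refl
  AdjIs-functional false false _   _   = refl
  AdjIs-functional true  false uv  ¬uv = ⊥-elim (¬uv uv)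
  AdjIs-functional false true  ¬uv uv  = ⊥-elim (¬uv uv)

  AdjIs⇒⇔T : ∀ b {u v} → AdjIs b u v → Adj G u v ⇔ T b
  AdjIs⇒⇔T true  uv  = mk⇔ (λ _ → tt) (λ _ → uv)
  AdjIs⇒⇔T false ¬uv = mk⇔ ¬uv (λ ())

  record Realizes (p : Fin 6 → Fin n) (H : Fin 6 → Fin 6 → Bool) : Set where
    constructor realizes
    field adjIs : ∀ i j → AdjIs (H i j) (p i) (p j)
  open Realizes

  Realizes-relabel : ∀ {p H₁ H₂} (σ : Fin 6 → Fin 6) →
    SameTable H₂ (λ i j → H₁ (σ i) (σ j)) → Realizes p H₁ → Realizes (p ∘ σ) H₂
  Realizes-relabel σ same r .adjIs i j rewrite same i j = r .adjIs (σ i) (σ j)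

  -- Injectivity is free: vertices with different adjacency columns in H
  -- have different neighbourhoods among the image.
  Realizes⇒InducedSub6 : ∀ {p H} → DistinctColumns H → Realizes p H → InducedSub6 H G
  Realizes⇒InducedSub6 {p} {H} distinct r =
    p , injective , λ i j → AdjIs⇒⇔T (H i j) (r .adjIs i j)
    where
    injective : ∀ {i j} → p i ≡ p j → i ≡ j
    injective {i} {j} pi≡pj = distinct i j λ k →
      AdjIs-functional (H k i) (H k j) (r .adjIs k i)
        (subst (AdjIs (H k j) (p k)) (≡-sym pi≡pj) (r .adjIs k j))

  InducedSub6-relabel : ∀ {p H₁} H₂ (σ : Fin 6 → Fin 6) → Realizes p H₁ →
    {True (sameTable? H₂ (λ i j → H₁ (σ i) (σ j)))} → {True (distinctColumns? H₂)} →
    InducedSub6 H₂ G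
  InducedSub6-relabel H₂ σ r {same} {distinct} =
    Realizes⇒InducedSub6 (toWitness distinct) (Realizes-relabel σ (toWitness same) r)

  -- One or two chords of the even side form, up to rotation, the chords of C6¹ or C6².
  ℋ-free⇒¬Realizes-hexagon : ℋ-free G → ∀ p b₀₂ b₂₄ b₀₄ → ¬ Realizes p (hexagon b₀₂ b₂₄ b₀₄)
  ℋ-free⇒¬Realizes-hexagon (¬C6 , ¬C6¹ , ¬C6² , ¬C6³) p = λ where
    false false false r → ¬C6  (InducedSub6-relabel C6-adj  id r)
    true  false false r → ¬C6¹ (InducedSub6-relabel C6¹-adj id r)
    false true  false r → ¬C6¹ (InducedSub6-relabel C6¹-adj rotate₂ r)
    false false true  r → ¬C6¹ (InducedSub6-relabel C6¹-adj (rotate₂ ∘ rotate₂) r)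
    true  true  false r → ¬C6² (InducedSub6-relabel C6²-adj id r)
    false true  true  r → ¬C6² (InducedSub6-relabel C6²-adj rotate₂ r)
    true  false true  r → ¬C6² (InducedSub6-relabel C6²-adj (rotate₂ ∘ rotate₂) r)
    true  true  true  r → ¬C6³ (InducedSub6-relabel C6³-adj id r)

  record Hexagon (p : Fin 6 → Fin n) : Set where
    field
      edge₀₁ : Adj G (p f0) (p f1)
      edge₁₂ : Adj G (p f1) (p f2)
      edge₂₃ : Adj G (p f2) (p f3)
      edge₃₄ : Adj G (p f3) (p f4)
      edge₄₅ : Adj G (p f4) (p f5)
      edge₀₅ : Adj G (p f0) (p f5)
      ¬edge₀₃ : ¬ Adj G (p f0) (p f3)
      ¬edge₁₄ : ¬ Adj G (p f1) (p f4)
      ¬edge₂₅ : ¬ Adj G (p f2) (p f5)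
      ¬edge₁₃ : ¬ Adj G (p f1) (p f3)
      ¬edge₃₅ : ¬ Adj G (p f3) (p f5)
      ¬edge₁₅ : ¬ Adj G (p f1) (p f5)
  open Hexagon

  Hexagon⇒Realizes : ∀ {p} b₀₂ b₂₄ b₀₄ → Hexagon p →
    AdjIs b₀₂ (p f0) (p f2) → AdjIs b₂₄ (p f2) (p f4) → AdjIs b₀₄ (p f0) (p f4) →
    Realizes p (hexagon b₀₂ b₂₄ b₀₄)
  Hexagon⇒Realizes {p} b₀₂ b₂₄ b₀₄ h c₀₂ c₂₄ c₀₄ = realizes table
    where
    table : ∀ i j → AdjIs (hexagon b₀₂ b₂₄ b₀₄ i j) (p i) (p j)
    table f0 f0 = irrefl G
    table f0 f1 = edge₀₁ h
    table f0 f2 = c₀₂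
    table f0 f3 = ¬edge₀₃ h
    table f0 f4 = c₀₄
    table f0 f5 = edge₀₅ h
    table f1 f0 = sym G (edge₀₁ h)
    table f1 f1 = irrefl G
    table f1 f2 = edge₁₂ h
    table f1 f3 = ¬edge₁₃ h
    table f1 f4 = ¬edge₁₄ h
    table f1 f5 = ¬edge₁₅ h
    table f2 f0 = AdjIs-sym b₀₂ c₀₂
    table f2 f1 = sym G (edge₁₂ h)
    table f2 f2 = irrefl G
    table f2 f3 = edge₂₃ h
    table f2 f4 = c₂₄
    table f2 f5 = ¬edge₂₅ h
    table f3 f0 = AdjIs-sym false (¬edge₀₃ h)
    table f3 f1 = AdjIs-sym false (¬edge₁₃ h)
    table f3 f2 = sym G (edge₂₃ h)
    table f3 f3 = irrefl G
    table f3 f4 = edge₃₄ h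
    table f3 f5 = ¬edge₃₅ h
    table f4 f0 = AdjIs-sym b₀₄ c₀₄
    table f4 f1 = AdjIs-sym false (¬edge₁₄ h)
    table f4 f2 = AdjIs-sym b₂₄ c₂₄
    table f4 f3 = sym G (edge₃₄ h)
    table f4 f4 = irrefl G
    table f4 f5 = edge₄₅ h
    table f5 f0 = sym G (edge₀₅ h)
    table f5 f1 = AdjIs-sym false (¬edge₁₅ h)
    table f5 f2 = AdjIs-sym false (¬edge₂₅ h)
    table f5 f3 = AdjIs-sym false (¬edge₃₅ h)
    table f5 f4 = sym G (edge₄₅ h)
    table f5 f5 = irrefl G

  ℋ-free⇒¬Hexagon : ℋ-free G → ∀ {p} → ¬ Hexagon p
  ℋ-free⇒¬Hexagon free {p} h
    with adjIs? (p f0) (p f2) | adjIs? (p f2) (p f4) | adjIs? (p f0) (p f4)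
  ... | b₀₂ , c₀₂ | b₂₄ , c₂₄ | b₀₄ , c₀₄ =
    ℋ-free⇒¬Realizes-hexagon free p b₀₂ b₂₄ b₀₄ (Hexagon⇒Realizes b₀₂ b₂₄ b₀₄ h c₀₂ c₂₄ c₀₄)

module _ {n : ℕ} (G : Graph n) (free : ℋ-free G) (K : Subset n)
         (clique : ∀ u v → u ∈ K → v ∈ K → u ≢ v → Dist2 G u v) where

  Dominates : Fin n → List (Fin n) → Set
  Dominates v M = All (λ u → u ∈ K → u ∈N[ G ] v) M

  Dominates-insert : ∀ {v a b M} → (b ∈ K → Adj G v b) →
    Dominates v (a ∷ M) → Dominates v (a ∷ b ∷ M)
  Dominates-insert vb (va ∷ vM) = va ∷ vb ∷ vM

  common-neighbour-dominates : ∀ {a b c v₀ v₁ z} → a ∈ K → b ∈ K → c ∈ K → a ≢ b →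
    Adj G v₀ a → ¬ Adj G v₀ b → Adj G v₁ b → ¬ Adj G v₁ a → Adj G a z → Adj G z b →
    Adj G v₀ c → Adj G v₁ c → Adj G z c
  common-neighbour-dominates {a} {b} {c} {v₀} {v₁} {z} aK bK cK a≢b v₀a ¬v₀b v₁b ¬v₁a az zb v₀c v₁c
    with c ≟ a | c ≟ b | adj? G z c
  ... | yes refl | _        | _       = sym G az
  ... | no _     | yes refl | _       = zb
  ... | no _     | no _     | yes zc  = zc
  ... | no c≢a   | no c≢b   | no ¬zc  = ⊥-elim (ℋ-free⇒¬Hexagon G free hexagon-v₀cv₁bza)
    where
    nonadjacent : ∀ {u w} → u ∈ K → w ∈ K → u ≢ w → ¬ Adj G u w
    nonadjacent uK wK u≢w = proj₁ (proj₂ (clique _ _ uK wK u≢w))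

    hexagon-v₀cv₁bza : Hexagon G (λ { f0 → v₀ ; f1 → c ; f2 → v₁ ; f3 → b ; f4 → z ; _ → a })
    hexagon-v₀cv₁bza = record
      { edge₀₁ = v₀c ; edge₁₂ = sym G v₁c ; edge₂₃ = v₁b
      ; edge₃₄ = sym G zb ; edge₄₅ = sym G az ; edge₀₅ = v₀a
      ; ¬edge₀₃ = ¬v₀b ; ¬edge₁₄ = ¬zc ∘ sym G ; ¬edge₂₅ = ¬v₁a
      ; ¬edge₁₃ = nonadjacent cK bK c≢b
      ; ¬edge₃₅ = nonadjacent bK aK (a≢b ∘ ≡-sym)
      ; ¬edge₁₅ = nonadjacent cK aK c≢a
      }

  Dominates-merge : ∀ {a b M} → a ∈ K → b ∈ K → a ≢ b →
    ∃[ v ] Dominates v (a ∷ M) → ∃[ v ] Dominates v (b ∷ M) → ∃[ v ] Dominates v (a ∷ b ∷ M)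
  Dominates-merge {a} {b} aK bK a≢b (v₀ , v₀a ∷ v₀M) (v₁ , v₁b ∷ v₁M)
    with adj? G v₀ b | adj? G v₁ a
  ... | yes v₀b | _       = v₀ , v₀a ∷ (λ _ → v₀b) ∷ v₀M
  ... | no _    | yes v₁a = v₁ , (λ _ → v₁a) ∷ v₁b ∷ v₁M
  ... | no ¬v₀b | no ¬v₁a with clique a b aK bK a≢b
  ...   | _ , _ , z , az , zb = z , (λ _ → sym G az) ∷ (λ _ → zb) ∷ All.zipWith z-dominates (v₀M , v₁M)
    where
    z-dominates : ∀ {c} → (c ∈ K → Adj G v₀ c) × (c ∈ K → Adj G v₁ c) → c ∈ K → Adj G z c
    z-dominates (v₀c , v₁c) cK = common-neighbour-dominates aK bK cK a≢b
      (v₀a aK) ¬v₀b (v₁b bK) ¬v₁a az zb (v₀c cK) (v₁c cK)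

  dominating-vertex : NoIsolated G → ∀ {a} M → a ∈ K → ∃[ v ] Dominates v (a ∷ M)
  dominating-vertex noIsolated {a} [] aK with noIsolated a
  ... | w , aw = w , (λ _ → sym G aw) ∷ []
  dominating-vertex noIsolated {a} (b ∷ M) aK with b ∈? K | a ≟ b
  ... | no b∉K | _ = let v , vaM = dominating-vertex noIsolated M aK
                     in v , Dominates-insert (⊥-elim ∘ b∉K) vaM
  ... | yes _ | yes refl = let v , vaM = dominating-vertex noIsolated M aK
                           in v , Dominates-insert (All.head vaM) vaM
  ... | yes bK | no a≢b = Dominates-merge aK bK a≢b
    (dominating-vertex noIsolated M aK) (dominating-vertex noIsolated M bK)

lemma4 : ∀ {n} (G : Graph n) → NoIsolated G → ℋ-free G →
    ∀ (K : Subset n) → IsStarClique G K →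
    ∃[ v ] (∀ (u : Fin n) → u ∈ K → u ∈N[ G ] v)
lemma4 {n} G noIsolated free K ((a , aK) , clique)
  with dominating-vertex G free K clique noIsolated (allFin n) aK
... | v , _ ∷ dominatesAll = v , λ u → All.lookup dominatesAll (∈-allFin u)
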